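{- Let $A=(A(1),\ldots,A(n))$ be an array of elements of a totally ordered set that is both $3$-sorted and $4$-sorted. If $(i,i+5)$ and $(j,j+5)$ are $5$-inversions of $A$ with $i<j$ that cross each other (i.e. $i<j<i+5<j+5$), then $j=i+3$ or $j=i+4$.
   Context: An array $A$ is $k$-sorted if $A(i)\le A(i+k)$ for all $1\le i\le n-k$. A $p$-inversion of $A$ is a pair $(i,i+p)$ with $1\le i<i+p\le n$ and $A(i)>A(i+p)$. -}

module Defs where

open import Level using (Level)
open import Data.Nat using (ℕ; _+_)
open import Data.Fin using (Fin; toℕ)
open import Data.Product using (_×_)
open import Relation.Binary.PropositionalEquality using (_≡_)
open import Relation.Binary.Bundles using (TotalOrder)
open import Relation.Nullary using (¬_)

-- Arrays of length n over the carrier of a total order, indexed by Fin n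
-- (positions 0..n-1 instead of 1..n; only differences of positions matter).
module _ {c ℓ₁ ℓ₂ : Level} (T : TotalOrder c ℓ₁ ℓ₂) where
  open TotalOrder T

  KSorted : {n : ℕ} → (Fin n → Carrier) → ℕ → Set (ℓ₂)
  KSorted {n} A k = (i j : Fin n) → toℕ j ≡ toℕ i + k → A i ≤ A j

  PInversion : {n : ℕ} → (Fin n → Carrier) → ℕ → Fin n → Fin n → Set ℓ₂
  PInversion A p i j = (toℕ j ≡ toℕ i + p) × ¬ (A i ≤ A j)

{-# OPTIONS --safe #-}
module Submission where

-- If (i, i+p) and (i+d, i+d+p) are p-inversions with p = d + q, then
-- A(i+d) ≤ A(i+p) < A(i) ≤ A(i+d+p) as soon as A is q-sorted and (d+p)-sorted,
-- contradicting the second inversion. For p = 5 the offsets d = 1 and d = 2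
-- need 4- and 6-sortedness, resp. 3- and 7-sortedness, and 6 = 3 + 3 and
-- 7 = 4 + 3 follow from 3- and 4-sortedness.

open import Defs
open import Data.Nat using (ℕ; zero; suc; _+_; _≤_; _<_; s≤s)
open import Data.Nat.Properties using (+-assoc; m≤m+n; ≤-trans; ≤-reflexive; ≤-<-trans)
open import Data.Fin using (Fin; toℕ; fromℕ<)
open import Data.Fin.Properties using (toℕ<n; toℕ-fromℕ<)
open import Data.Sum using (_⊎_; inj₁; inj₂)
open import Data.Product using (_,_)
open import Data.Empty using (⊥; ⊥-elim)
open import Relation.Binary.PropositionalEquality using (_≡_; refl; sym; trans; cong)
open import Relation.Binary.Bundles using (TotalOrder)
import Relation.Binary.Properties.TotalOrder as TotalOrderProperties

<-offsets-below-5 : ∀ a b → a < b → b < a + 5 →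
                    b ≡ a + 1 ⊎ b ≡ a + 2 ⊎ b ≡ a + 3 ⊎ b ≡ a + 4
<-offsets-below-5 zero 1 _ _ = inj₁ refl
<-offsets-below-5 zero 2 _ _ = inj₂ (inj₁ refl)
<-offsets-below-5 zero 3 _ _ = inj₂ (inj₂ (inj₁ refl))
<-offsets-below-5 zero 4 _ _ = inj₂ (inj₂ (inj₂ refl))
<-offsets-below-5 zero (suc (suc (suc (suc (suc _))))) _ (s≤s (s≤s (s≤s (s≤s (s≤s ())))))
<-offsets-below-5 (suc a) (suc b) (s≤s a<b) (s≤s b<a+5)
  with <-offsets-below-5 a b a<b b<a+5
... | inj₁ e                 = inj₁ (cong suc e)
... | inj₂ (inj₁ e)          = inj₂ (inj₁ (cong suc e))
... | inj₂ (inj₂ (inj₁ e))   = inj₂ (inj₂ (inj₁ (cong suc e)))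
... | inj₂ (inj₂ (inj₂ e))   = inj₂ (inj₂ (inj₂ (cong suc e)))

module _ {c ℓ₁ ℓ₂} (T : TotalOrder c ℓ₁ ℓ₂) where
  open TotalOrder T using (Carrier) renaming (trans to ≤-trans′)
  open TotalOrderProperties T using (≰⇒≥)

  KSorted-+ : ∀ {n} {A : Fin n → Carrier} {k l} →
              KSorted T A k → KSorted T A l → KSorted T A (k + l)
  KSorted-+ {k = k} {l} sortedₖ sortedₗ i j j≡i+k+l =
    ≤-trans′ (sortedₖ i mid (toℕ-fromℕ< _))
             (sortedₗ mid j (trans j≡i+k+l (trans (sym (+-assoc (toℕ i) k l))
                                                  (cong (_+ l) (sym (toℕ-fromℕ< _))))))
    where
    i+k≤j : toℕ i + k ≤ toℕ j
    i+k≤j = ≤-trans (m≤m+n (toℕ i + k) l)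
                    (≤-reflexive (trans (+-assoc (toℕ i) k l) (sym j≡i+k+l)))
    mid : Fin _
    mid = fromℕ< (≤-<-trans i+k≤j (toℕ<n j))

  no-crossing-inversions-at-offset : ∀ {n} {A : Fin n → Carrier} d q →
    KSorted T A q → KSorted T A (d + (d + q)) →
    (i i′ j j′ : Fin n) → PInversion T A (d + q) i i′ → PInversion T A (d + q) j j′ →
    toℕ j ≡ toℕ i + d → ⊥
  no-crossing-inversions-at-offset d q sorted-q sorted-d+p i i′ j j′
                                (i′≡i+p , Ai≰Ai′) (j′≡j+p , Aj≰Aj′) j≡i+d =
    Aj≰Aj′ (≤-trans′ (sorted-q j i′ i′≡j+q)
                     (≤-trans′ (≰⇒≥ Ai≰Ai′) (sorted-d+p i j′ j′≡i+d+p)))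
    where
    i′≡j+q : toℕ i′ ≡ toℕ j + q
    i′≡j+q = trans i′≡i+p (trans (sym (+-assoc (toℕ i) d q)) (cong (_+ q) (sym j≡i+d)))
    j′≡i+d+p : toℕ j′ ≡ toℕ i + (d + (d + q))
    j′≡i+d+p = trans j′≡j+p (trans (cong (_+ (d + q)) j≡i+d) (+-assoc (toℕ i) d (d + q)))

lemma10 : ∀ {c ℓ₁ ℓ₂} (T : TotalOrder c ℓ₁ ℓ₂) (n : ℕ) (A : Fin n → TotalOrder.Carrier T)
              → KSorted T A 3 → KSorted T A 4
              → (i i₅ j j₅ : Fin n)
              → PInversion T A 5 i i₅ → PInversion T A 5 j j₅
              → toℕ i < toℕ j → toℕ j < toℕ i + 5
              → (toℕ j ≡ toℕ i + 3) ⊎ (toℕ j ≡ toℕ i + 4)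
lemma10 T _ _ sorted₃ sorted₄ i i₅ j j₅ inv-i inv-j i<j j<i+5
  with <-offsets-below-5 (toℕ i) (toℕ j) i<j j<i+5
... | inj₁ j≡i+1 =
  ⊥-elim (no-crossing-inversions-at-offset T 1 4 sorted₄ (KSorted-+ T sorted₃ sorted₃)
                                        i i₅ j j₅ inv-i inv-j j≡i+1)
... | inj₂ (inj₁ j≡i+2) =
  ⊥-elim (no-crossing-inversions-at-offset T 2 3 sorted₃ (KSorted-+ T sorted₄ sorted₃)
                                        i i₅ j j₅ inv-i inv-j j≡i+2)
... | inj₂ (inj₂ (inj₁ j≡i+3)) = inj₁ j≡i+3
... | inj₂ (inj₂ (inj₂ j≡i+4)) = inj₂ j≡i+4
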